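{- For all positive integers $k,d$ there exists $s_0$ such that for every integer $s\ge s_0$ the following holds. Let $X\subseteq\mathbb Z^d\cap B^d({\bf 0},2k)$ and let $L_X$ be the sublattice of $\mathbb Z^d$ generated by $X$. Then for any vector ${\bf x}\in L_X\cap B^d({\bf 0},2k)$ there exist multisets $S_1,S_2$ of elements of $X$ such that $|S_1|,|S_2|\le s$ and $\sum_{{\bf v}\in S_1}{\bf v}-\sum_{{\bf v}\in S_2}{\bf v}={\bf x}$.
   Context: $B^d({\bf 0},\rho)$ is the closed Euclidean ball of radius $\rho$ about the origin in $\mathbb R^d$. The sublattice generated by $X$ is the additive subgroup of $\mathbb Z^d$ generated by $X$. Multiset sizes and sums are counted with multiplicity. -}

module Defs where

open import Data.Nat using (ℕ)
open import Data.Integer using (ℤ; +_; _+_; _*_; -_; _≤_)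
open import Data.Vec using (Vec; zipWith; map; replicate; foldr)
open import Data.List using (List)
import Data.List as L

Point : ℕ → Set
Point d = Vec ℤ d

0ᵥ : ∀ {d} → Point d
0ᵥ = replicate _ (+ 0)

_+ᵥ_ : ∀ {d} → Point d → Point d → Point d
_+ᵥ_ = zipWith _+_

-ᵥ_ : ∀ {d} → Point d → Point d
-ᵥ_ = map -_

_-ᵥ_ : ∀ {d} → Point d → Point d → Point d
u -ᵥ v = u +ᵥ (-ᵥ v)

normSq : ∀ {d} → Point d → ℤ
normSq = foldr _ (λ a acc → a * a + acc) (+ 0)

InBall : ∀ {d} → ℕ → Point d → Set
InBall r v = normSq v ≤ (+ r) * (+ r)

data InLattice {d : ℕ} (X : Point d → Set) : Point d → Set where
  gen  : ∀ {v} → X v → InLattice X v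
  zero : InLattice X 0ᵥ
  add  : ∀ {u v} → InLattice X u → InLattice X v → InLattice X (u +ᵥ v)
  neg  : ∀ {v} → InLattice X v → InLattice X (-ᵥ v)

-- sum of a multiset (list, counted with multiplicity)
sumᵥ : ∀ {d} → List (Point d) → Point d
sumᵥ = L.foldr _+ᵥ_ 0ᵥ

-- Write x as the sum of a list of signed generators ±v; every entry of every item lies in
-- [-A, A] and every entry of the total in [-T, T], with A = T = 2k. Deleting sublists of sum 0
-- leaves a list that still sums to x, and its positive and negative items give S₁ and S₂. The
-- length of the leftover is bounded by induction on d. In the first coordinate, a list of
-- integers in [-A, A] with sum in [-T, T] that is longer than A² + A³ + T contains a nonempty
-- zero-sum sublist of at most 2A + 1 items: a single 0, or else both signs occur more than A²
-- times, so by pigeonhole some value a > 0 and some value -b < 0 each occur A times, and b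
-- copies of a with a copies of -b sum to 0. Cutting out such blocks leaves at most
-- A² + A³ + T items; the sums of the remaining d - 1 coordinates over the blocks form a list with
-- bounded entries and bounded total, and the induction hypothesis finds a zero-sum family of
-- blocks, which then sums to 0 in all d coordinates.

module Submission where

open import Defs
open import Algebra.Bundles using (AbelianGroup)
open import Algebra.Core using (Op₂)
open import Algebra.Structures using (IsAbelianGroup; IsCommutativeMonoid)
import Algebra.Properties.AbelianGroup as AbelianGroupProperties
import Algebra.Properties.CommutativeSemigroup as CommutativeSemigroupProperties
open import Data.Empty using (⊥; ⊥-elim)
open import Data.Integer as ℤ using (ℤ; +_; -[1+_]; ∣_∣; _⊖_) renaming (_+_ to _+ℤ_)
import Data.Integer.Properties as ℤ
open import Data.List using (List; []; _∷_; _++_; [_]; concat; foldr; map; partition; take; drop; length)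
import Data.List.Properties as List
open import Data.List.Relation.Binary.Permutation.Propositional
  using (_↭_; ↭-refl; ↭-trans; ↭-reflexive; ↭-isEquivalence; ↭-setoid; ↭⇒↭ₛ; ↭⇒↭ₛ′; ↭ₛ⇒↭;
         module PermutationReasoning)
open import Data.List.Relation.Binary.Permutation.Propositional.Properties
  using (All-resp-↭; ↭-length; ++⁺ˡ; ++⁺ʳ; ++-comm; shifts; ++-isCommutativeMonoid)
  renaming (map⁺ to ↭-map⁺)
import Data.List.Relation.Binary.Permutation.Setoid.Properties as ↭ₛ
open import Data.List.Relation.Unary.All as All using (All; []; _∷_)
import Data.List.Relation.Unary.All.Properties as All
open import Data.Nat as ℕ using (ℕ; zero; suc; z≤n; s≤s; _≤_; _<_; _+_; _*_)
import Data.Nat.Properties as ℕ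
open import Data.Product using (Σ; _×_; _,_; ∃-syntax; proj₁; proj₂)
open import Data.Sum using (_⊎_; inj₁; inj₂; swap)
open import Data.Vec using ([]; _∷_; head; tail)
open import Data.Vec.Properties
  using (zipWith-assoc; zipWith-comm; zipWith-identityˡ; zipWith-identityʳ; zipWith-inverseˡ; zipWith-inverseʳ)
open import Data.Vec.Relation.Unary.All as Vec using ([]; _∷_)
open import Function using (_∘_)
open import Level using (0ℓ)
open import Relation.Binary.PropositionalEquality hiding ([_])
open import Relation.Nullary using (yes; no; ¬_)
open import Relation.Unary using (Decidable; ∁)

+ᵥ-0-isAbelianGroup : ∀ {d} → IsAbelianGroup _≡_ (_+ᵥ_ {d}) 0ᵥ (-ᵥ_)
+ᵥ-0-isAbelianGroup = record
  { isGroup = record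
    { isMonoid = record
      { isSemigroup = record
        { isMagma = record { isEquivalence = isEquivalence ; ∙-cong = cong₂ _+ᵥ_ }
        ; assoc = zipWith-assoc ℤ.+-assoc
        }
      ; identity = zipWith-identityˡ ℤ.+-identityˡ , zipWith-identityʳ ℤ.+-identityʳ
      }
    ; inverse = zipWith-inverseˡ ℤ.+-inverseˡ , zipWith-inverseʳ ℤ.+-inverseʳ
    ; ⁻¹-cong = cong (-ᵥ_)
    }
  ; comm = zipWith-comm ℤ.+-comm
  }

+ᵥ-0-abelianGroup : ℕ → AbelianGroup 0ℓ 0ℓ
+ᵥ-0-abelianGroup d = record { isAbelianGroup = +ᵥ-0-isAbelianGroup {d} }

module ℤᵈ {d : ℕ} where
  open AbelianGroup (+ᵥ-0-abelianGroup d) public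
  open AbelianGroupProperties (+ᵥ-0-abelianGroup d) public
  open CommutativeSemigroupProperties commutativeSemigroup public using (x∙yz≈y∙xz)

∑ : {A I : Set} → Op₂ A → A → (I → A) → List I → A
∑ _∙_ ε f = foldr _∙_ ε ∘ map f

∑ℤ : {I : Set} → (I → ℤ) → List I → ℤ
∑ℤ = ∑ _+ℤ_ (+ 0)

∑ᵥ : ∀ {d} {I : Set} → (I → Point d) → List I → Point d
∑ᵥ = ∑ _+ᵥ_ 0ᵥ

module ∑-Properties {A : Set} {_∙_ : Op₂ A} {ε : A}
  (isCommutativeMonoid : IsCommutativeMonoid _≡_ _∙_ ε) where

  open IsCommutativeMonoid isCommutativeMonoid using (assoc; identityˡ)
  open ≡-Reasoning

  module _ {I : Set} (f : I → A) where

    ∑-++ : ∀ l m → ∑ _∙_ ε f (l ++ m) ≡ ∑ _∙_ ε f l ∙ ∑ _∙_ ε f m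
    ∑-++ []      m = sym (identityˡ _)
    ∑-++ (i ∷ l) m = trans (cong (f i ∙_) (∑-++ l m)) (sym (assoc _ _ _))

    ∑-↭ : ∀ {l m} → l ↭ m → ∑ _∙_ ε f l ≡ ∑ _∙_ ε f m
    ∑-↭ p = ↭ₛ.foldr-commMonoid (setoid A) isCommutativeMonoid (↭⇒↭ₛ (↭-map⁺ f p))

    ∑-ε : ∀ {l} → All (λ i → f i ≡ ε) l → ∑ _∙_ ε f l ≡ ε
    ∑-ε []         = refl
    ∑-ε (fi≡ε ∷ p) = trans (cong₂ _∙_ fi≡ε (∑-ε p)) (identityˡ ε)

    ∑-concat : ∀ bs → ∑ _∙_ ε (∑ _∙_ ε f) bs ≡ ∑ _∙_ ε f (concat bs)
    ∑-concat []       = refl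
    ∑-concat (b ∷ bs) = trans (cong (∑ _∙_ ε f b ∙_) (∑-concat bs)) (sym (∑-++ b (concat bs)))

    ∑-↭-zeroSum : ∀ {l} l₀ r → l ↭ l₀ ++ r → ∑ _∙_ ε f l₀ ≡ ε → ∑ _∙_ ε f l ≡ ∑ _∙_ ε f r
    ∑-↭-zeroSum {l} l₀ r p ∑l₀≡ε = begin
      ∑ _∙_ ε f l                        ≡⟨ ∑-↭ p ⟩
      ∑ _∙_ ε f (l₀ ++ r)                ≡⟨ ∑-++ l₀ r ⟩
      ∑ _∙_ ε f l₀ ∙ ∑ _∙_ ε f r         ≡⟨ cong (_∙ ∑ _∙_ ε f r) ∑l₀≡ε ⟩
      ε ∙ ∑ _∙_ ε f r                    ≡⟨ identityˡ _ ⟩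
      ∑ _∙_ ε f r                        ∎

module _ {A B : Set} {_∙_ : Op₂ A} {ε : A} {_◦_ : Op₂ B} {ε′ : B}
  (φ : A → B) (φ-ε : φ ε ≡ ε′) (φ-∙ : ∀ x y → φ (x ∙ y) ≡ φ x ◦ φ y) where

  ∑-homo : ∀ {I : Set} (f : I → A) l → φ (∑ _∙_ ε f l) ≡ ∑ _◦_ ε′ (φ ∘ f) l
  ∑-homo f []      = φ-ε
  ∑-homo f (i ∷ l) = trans (φ-∙ (f i) _) (cong (φ (f i) ◦_) (∑-homo f l))

module ∑ℤ = ∑-Properties ℤ.+-0-isCommutativeMonoid
module ∑ᵥ {d : ℕ} = ∑-Properties (IsAbelianGroup.isCommutativeMonoid (+ᵥ-0-isAbelianGroup {d}))

∑ᵥ-∷ : ∀ {d} {I : Set} (f : I → Point (suc d)) l → ∑ᵥ f l ≡ ∑ℤ (head ∘ f) l ∷ ∑ᵥ (tail ∘ f) l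
∑ᵥ-∷ f []      = refl
∑ᵥ-∷ f (i ∷ l) = trans (cong (f i +ᵥ_) (∑ᵥ-∷ f l)) (+ᵥ-∷ (f i))
  where
  +ᵥ-∷ : ∀ {d} (u : Point (suc d)) {a v} → u +ᵥ (a ∷ v) ≡ (head u +ℤ a) ∷ (tail u +ᵥ v)
  +ᵥ-∷ (b ∷ u) = refl

InBox : ∀ {d} → ℕ → Point d → Set
InBox A = Vec.All (λ a → ∣ a ∣ ≤ A)

InBox-mono : ∀ {d A B} {v : Point d} → A ≤ B → InBox A v → InBox B v
InBox-mono A≤B = Vec.map (λ a≤A → ℕ.≤-trans a≤A A≤B)

InBox-0 : ∀ {d A} → InBox A (0ᵥ {d})
InBox-0 {zero}  = []
InBox-0 {suc d} = ℕ.z≤n ∷ InBox-0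

InBox-+ : ∀ {d A B} {u v : Point d} → InBox A u → InBox B v → InBox (A + B) (u +ᵥ v)
InBox-+ []           []           = []
InBox-+ {u = a ∷ _} {b ∷ _} (a≤A ∷ u∈A) (b≤B ∷ v∈B) =
  ℕ.≤-trans (ℤ.∣i+j∣≤∣i∣+∣j∣ a b) (ℕ.+-mono-≤ a≤A b≤B) ∷ InBox-+ u∈A v∈B

InBox-neg : ∀ {d A} {v : Point d} → InBox A v → InBox A (-ᵥ v)
InBox-neg []                       = []
InBox-neg {v = a ∷ _} (a≤A ∷ v∈A) = subst (_≤ _) (sym (ℤ.∣-i∣≡∣i∣ a)) a≤A ∷ InBox-neg v∈A

InBox-∑ : ∀ {d A} {I : Set} (f : I → Point d) {l} → All (InBox A ∘ f) l → InBox (length l * A) (∑ᵥ f l)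
InBox-∑ f []           = InBox-0
InBox-∑ f (fi∈A ∷ f∈A) = InBox-+ fi∈A (InBox-∑ f f∈A)

InBox-head : ∀ {d A} {v : Point (suc d)} → InBox A v → ∣ head v ∣ ≤ A
InBox-head {v = _ ∷ _} = Vec.head

InBox-tail : ∀ {d A} {v : Point (suc d)} → InBox A v → InBox A (tail v)
InBox-tail {v = _ ∷ _} = Vec.tail

normSqℕ : ∀ {d} → Point d → ℕ
normSqℕ []      = 0
normSqℕ (a ∷ v) = ∣ a ∣ * ∣ a ∣ + normSqℕ v

normSq≡+normSqℕ : ∀ {d} (v : Point d) → normSq v ≡ + normSqℕ v
normSq≡+normSqℕ []      = refl
normSq≡+normSqℕ (a ∷ v) = cong₂ _+ℤ_ (i*i≡+∣i∣*∣i∣ a) (normSq≡+normSqℕ v)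
  where
  i*i≡+∣i∣*∣i∣ : ∀ i → i ℤ.* i ≡ + (∣ i ∣ * ∣ i ∣)
  i*i≡+∣i∣*∣i∣ (+ n)    = ℤ.+◃n≡+n (n * n)
  i*i≡+∣i∣*∣i∣ -[1+ n ] = ℤ.+◃n≡+n (suc n * suc n)

m*m≤n*n⇒m≤n : ∀ m n → m * m ≤ n * n → m ≤ n
m*m≤n*n⇒m≤n m n m*m≤n*n = ℕ.≮⇒≥ λ n<m → ℕ.<⇒≱ (ℕ.*-mono-< n<m n<m) m*m≤n*n

normSqℕ≤⇒InBox : ∀ {d} r (v : Point d) → normSqℕ v ≤ r * r → InBox r v
normSqℕ≤⇒InBox r []      _ = []
normSqℕ≤⇒InBox r (a ∷ v) ≤r*r =
  m*m≤n*n⇒m≤n ∣ a ∣ r (ℕ.≤-trans (ℕ.m≤m+n _ (normSqℕ v)) ≤r*r) ∷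
  normSqℕ≤⇒InBox r v (ℕ.≤-trans (ℕ.m≤n+m (normSqℕ v) _) ≤r*r)

InBall⇒InBox : ∀ {d} r {v : Point d} → InBall r v → InBox r v
InBall⇒InBox r {v} v∈B =
  normSqℕ≤⇒InBox r v (ℤ.drop‿+≤+ (subst₂ ℤ._≤_ (normSq≡+normSqℕ v) (sym (ℤ.pos-* r r)) v∈B))

-- Sub-multisets

infix 4 _⊑_

_⊑_ : {I : Set} → List I → List I → Set
b ⊑ l = ∃[ r ] l ↭ b ++ r

module _ {I : Set} where

  ↭⇒⊑ : ∀ {l m : List I} → l ↭ m → m ⊑ l
  ↭⇒⊑ {m = m} l↭m = [] , ↭-trans l↭m (↭-reflexive (sym (List.++-identityʳ m)))

  ⊑-trans : ∀ {b m l : List I} → b ⊑ m → m ⊑ l → b ⊑ l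
  ⊑-trans {b} (r₁ , m↭b++r₁) (r₂ , l↭m++r₂) = r₁ ++ r₂ , (begin
      _                 ↭⟨ l↭m++r₂ ⟩
      _ ++ r₂           ↭⟨ ++⁺ʳ r₂ m↭b++r₁ ⟩
      (b ++ r₁) ++ r₂   ≡⟨ List.++-assoc b r₁ r₂ ⟩
      b ++ r₁ ++ r₂     ∎)
    where open PermutationReasoning

  ⊑-++⁺ : ∀ {b₁ l₁ b₂ l₂ : List I} → b₁ ⊑ l₁ → b₂ ⊑ l₂ → b₁ ++ b₂ ⊑ l₁ ++ l₂
  ⊑-++⁺ {b₁} {l₁} {b₂} {l₂} (r₁ , l₁↭) (r₂ , l₂↭) = r₁ ++ r₂ , (begin
      l₁ ++ l₂                    ↭⟨ ++⁺ʳ l₂ l₁↭ ⟩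
      (b₁ ++ r₁) ++ l₂            ↭⟨ ++⁺ˡ (b₁ ++ r₁) l₂↭ ⟩
      (b₁ ++ r₁) ++ b₂ ++ r₂      ≡⟨ List.++-assoc b₁ r₁ (b₂ ++ r₂) ⟩
      b₁ ++ r₁ ++ b₂ ++ r₂        ↭⟨ ++⁺ˡ b₁ (shifts r₁ b₂) ⟩
      b₁ ++ b₂ ++ r₁ ++ r₂        ≡⟨ List.++-assoc b₁ b₂ (r₁ ++ r₂) ⟨
      (b₁ ++ b₂) ++ r₁ ++ r₂      ∎)
    where open PermutationReasoning

  ⊑-complement : ∀ {b r l : List I} → l ↭ b ++ r → r ⊑ l
  ⊑-complement {b} {r} l↭b++r = b , ↭-trans l↭b++r (++-comm b r)

  All-⊑ : ∀ {P : I → Set} {b l : List I} → b ⊑ l → All P l → All P b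
  All-⊑ {b = b} (_ , l↭b++r) = All.++⁻ˡ b ∘ All-resp-↭ l↭b++r

  length-⊑ : ∀ {b l : List I} → (p : b ⊑ l) → length l ≡ length b + length (proj₁ p)
  length-⊑ {b} (_ , l↭b++r) = trans (↭-length l↭b++r) (List.length-++ b)

  splitBy : ∀ {P : I → Set} → Decidable P → ∀ l →
    ∃[ a ] ∃[ b ] (l ↭ a ++ b × All P a × All (∁ P) b)
  splitBy {P} P? l =
    proj₁ (partition P? l) , proj₂ (partition P? l) ,
    ↭ₛ⇒↭ (↭ₛ.partition-↭ (setoid I) P? l) , All.partition-All P? l

  prefix : ∀ n (l : List I) → n ≤ length l → ∃[ b ] (b ⊑ l × length b ≡ n)
  prefix n l n≤|l| =
    take n l , (drop n l , ↭-reflexive (sym (List.take++drop≡id n l))) ,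
    trans (List.length-take n l) (ℕ.m≤n⇒m⊓n≡m n≤|l|)

-- Short zero-sum blocks of integers

infix 4 _∈1‥_

_∈1‥_ : ℤ → ℕ → Set
z ∈1‥ A = ∃[ a ] (1 ≤ a × a ≤ A × z ≡ + a)

∈1‥-pred : ∀ {z A} → z ∈1‥ suc A → z ≢ + suc A → z ∈1‥ A
∈1‥-pred (a , 1≤a , a≤1+A , refl) z≢1+A =
  a , 1≤a , ℕ.≤-pred (ℕ.≤∧≢⇒< a≤1+A (z≢1+A ∘ cong (+_))) , refl

nonNeg⇒∈1‥ : ∀ {A} z → ∣ z ∣ ≤ A × z ≢ + 0 → + 0 ℤ.≤ z → z ∈1‥ A
nonNeg⇒∈1‥ (+ zero)  (_ , z≢0)   _ = ⊥-elim (z≢0 refl)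
nonNeg⇒∈1‥ (+ suc n) (z≤A , _)   _ = suc n , s≤s z≤n , z≤A , refl

neg⇒-∈1‥ : ∀ {A} z → ∣ z ∣ ≤ A × z ≢ + 0 → ¬ (+ 0 ℤ.≤ z) → ℤ.- z ∈1‥ A
neg⇒-∈1‥ (+ n)    _         0≰z = ⊥-elim (0≰z (ℤ.+≤+ z≤n))
neg⇒-∈1‥ -[1+ n ] (z≤A , _) _   = suc n , s≤s z≤n , z≤A , refl

pigeonhole : ∀ {I : Set} (h : I → ℤ) A M l → All (λ i → h i ∈1‥ A) l → A * M < length l →
  ∃[ a ] (1 ≤ a × a ≤ A × ∃[ b ] (b ⊑ l × All (λ i → h i ≡ + a) b × length b ≡ M))
pigeonhole h zero M (_ ∷ _) ((a , 1≤a , a≤0 , _) ∷ _) _ = ⊥-elim (ℕ.<⇒≱ 1≤a a≤0)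
pigeonhole h (suc A) M l h∈ 1+A*M<|l| with splitBy (λ i → h i ℤ.≟ + suc A) l
... | e , o , l↭e++o , e≡ , o≢ with M ℕ.≤? length e
...   | yes M≤|e| =
  let b , b⊑e , |b|≡M = prefix M e M≤|e|
  in suc A , s≤s z≤n , ℕ.≤-refl , b , ⊑-trans b⊑e (o , l↭e++o) , All-⊑ b⊑e e≡ , |b|≡M
...   | no M≰|e| =
  let a , 1≤a , a≤A , b , b⊑o , b≡ , |b|≡M = pigeonhole h A M o o∈ A*M<|o|
  in a , 1≤a , ℕ.m≤n⇒m≤1+n a≤A , b , ⊑-trans b⊑o (⊑-complement l↭e++o) , b≡ , |b|≡M
  where
  o∈ : All (λ i → h i ∈1‥ A) o
  o∈ = All.zipWith (λ (i∈ , i≢) → ∈1‥-pred i∈ i≢) (All.++⁻ʳ e (All-resp-↭ l↭e++o h∈) , o≢)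
  A*M<|o| : A * M < length o
  A*M<|o| = ℕ.+-cancelˡ-< M _ _ (begin-strict
    M + A * M            <⟨ 1+A*M<|l| ⟩
    length l             ≡⟨ ↭-length l↭e++o ⟩
    length (e ++ o)      ≡⟨ List.length-++ e ⟩
    length e + length o  <⟨ ℕ.+-monoˡ-< (length o) (ℕ.≰⇒> M≰|e|) ⟩
    M + length o         ∎)
    where open ℕ.≤-Reasoning

∑ℤ-∈1‥ : ∀ {I : Set} (h : I → ℤ) {A l} → All (λ i → h i ∈1‥ A) l →
  ∃[ s ] (∑ℤ h l ≡ + s × length l ≤ s × s ≤ length l * A)
∑ℤ-∈1‥ h []                               = 0 , refl , z≤n , z≤n
∑ℤ-∈1‥ h ((a , 1≤a , a≤A , hi≡a) ∷ h∈) =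
  let s , ∑≡s , |l|≤s , s≤|l|*A = ∑ℤ-∈1‥ h h∈
  in a + s , cong₂ _+ℤ_ hi≡a ∑≡s , ℕ.+-mono-≤ 1≤a |l|≤s , ℕ.+-mono-≤ a≤A s≤|l|*A

∑ℤ-const : ∀ {I : Set} (h : I → ℤ) {a l} → All (λ i → h i ≡ + a) l → ∑ℤ h l ≡ + (length l * a)
∑ℤ-const h []            = refl
∑ℤ-const h (hi≡a ∷ h≡a) = cong₂ _+ℤ_ hi≡a (∑ℤ-const h h≡a)

∑ℤ-neg : ∀ {I : Set} (h : I → ℤ) l → ∑ℤ h l ≡ ℤ.- ∑ℤ (ℤ.-_ ∘ h) l
∑ℤ-neg h l = trans (sym (ℤ.neg-involutive _)) (cong ℤ.-_ (∑-homo ℤ.-_ refl ℤ.neg-distrib-+ h l))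

∣m⊖n∣≤o⇒n≤m+o : ∀ m n o → ∣ m ⊖ n ∣ ≤ o → n ≤ m + o
∣m⊖n∣≤o⇒n≤m+o m n o ∣m⊖n∣≤o with ℕ.≤-total m n
... | inj₁ m≤n = ℕ.≤-trans (ℕ.m≤n+m∸n n m) (ℕ.+-monoʳ-≤ m (subst (_≤ o) (ℤ.∣⊖∣-≤ m≤n) ∣m⊖n∣≤o))
... | inj₂ n≤m = ℕ.≤-trans n≤m (ℕ.m≤m+n m o)

zeroSumThreshold : ℕ → ℕ → ℕ
zeroSumThreshold A T = A * A + (A * A * A + T)

shortSide⇒≤zeroSumThreshold : ∀ {A T p n sp sn} → p ≤ A * A → sp ≤ p * A → n ≤ sn → sn ≤ sp + T →
  p + n ≤ zeroSumThreshold A T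
shortSide⇒≤zeroSumThreshold {A} {T} {n = n} {sp} {sn} p≤A*A sp≤p*A n≤sn sn≤sp+T =
  ℕ.+-mono-≤ p≤A*A (begin
    n              ≤⟨ n≤sn ⟩
    sn             ≤⟨ sn≤sp+T ⟩
    sp + T         ≤⟨ ℕ.+-monoˡ-≤ T (ℕ.≤-trans sp≤p*A (ℕ.*-monoˡ-≤ A p≤A*A)) ⟩
    A * A * A + T  ∎)
  where open ℕ.≤-Reasoning

-- The two signed totals differ by at most T, so if one side has at most A² items (total at
-- most A³), the other has at most A³ + T items.
bothSidesLong : ∀ {I : Set} (h : I → ℤ) {A T} (P N : List I) →
  All (λ i → h i ∈1‥ A) P → All (λ i → ℤ.- h i ∈1‥ A) N →
  ∣ ∑ℤ h (P ++ N) ∣ ≤ T → zeroSumThreshold A T < length (P ++ N) →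
  A * A < length P × A * A < length N
bothSidesLong h {A} {T} P N hP hN ∣∑∣≤T C<|P++N|
  with ∑ℤ-∈1‥ h hP | ∑ℤ-∈1‥ (ℤ.-_ ∘ h) hN
... | sP , ∑P≡ , |P|≤sP , sP≤ | sN , ∑N≡ , |N|≤sN , sN≤ =
    ℕ.≰⇒> (λ |P|≤A*A → too-long (shortSide⇒≤zeroSumThreshold |P|≤A*A sP≤ |N|≤sN sN≤sP+T))
  , ℕ.≰⇒> (λ |N|≤A*A → too-long (subst (_≤ zeroSumThreshold A T) (ℕ.+-comm (length N) (length P))
                                   (shortSide⇒≤zeroSumThreshold |N|≤A*A sN≤ |P|≤sP sP≤sN+T)))
  where
  ∑≡sP⊖sN : ∑ℤ h (P ++ N) ≡ sP ⊖ sN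
  ∑≡sP⊖sN = begin
    ∑ℤ h (P ++ N)       ≡⟨ ∑ℤ.∑-++ h P N ⟩
    ∑ℤ h P +ℤ ∑ℤ h N    ≡⟨ cong₂ _+ℤ_ ∑P≡ (trans (∑ℤ-neg h N) (cong ℤ.-_ ∑N≡)) ⟩
    + sP +ℤ ℤ.- + sN    ≡⟨ ℤ.m-n≡m⊖n sP sN ⟩
    sP ⊖ sN             ∎
    where open ≡-Reasoning
  ∣sP⊖sN∣≤T : ∣ sP ⊖ sN ∣ ≤ T
  ∣sP⊖sN∣≤T = subst (λ z → ∣ z ∣ ≤ T) ∑≡sP⊖sN ∣∑∣≤T
  sN≤sP+T : sN ≤ sP + T
  sN≤sP+T = ∣m⊖n∣≤o⇒n≤m+o sP sN T ∣sP⊖sN∣≤T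
  sP≤sN+T : sP ≤ sN + T
  sP≤sN+T = ∣m⊖n∣≤o⇒n≤m+o sN sP T (subst (_≤ T) (ℤ.∣m⊖n∣≡∣n⊖m∣ sP sN) ∣sP⊖sN∣≤T)
  too-long : length P + length N ≤ zeroSumThreshold A T → ⊥
  too-long = ℕ.<⇒≱ (subst (_ <_) (List.length-++ P) C<|P++N|)

∑ℤ-balanced : ∀ {I : Set} (h : I → ℤ) {a b} (c₁ c₂ : List I) →
  All (λ i → h i ≡ + a) c₁ → All (λ i → ℤ.- h i ≡ + b) c₂ → length c₁ ≡ b → length c₂ ≡ a →
  ∑ℤ h (c₁ ++ c₂) ≡ + 0
∑ℤ-balanced h {a} {b} c₁ c₂ hc₁ hc₂ refl refl = begin
  ∑ℤ h (c₁ ++ c₂)                        ≡⟨ ∑ℤ.∑-++ h c₁ c₂ ⟩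
  ∑ℤ h c₁ +ℤ ∑ℤ h c₂                     ≡⟨ cong (∑ℤ h c₁ +ℤ_) (∑ℤ-neg h c₂) ⟩
  ∑ℤ h c₁ +ℤ ℤ.- ∑ℤ (ℤ.-_ ∘ h) c₂        ≡⟨ cong₂ (λ x y → x +ℤ ℤ.- y) (∑ℤ-const h hc₁) (∑ℤ-const (ℤ.-_ ∘ h) hc₂) ⟩
  + (b * a) +ℤ ℤ.- + (a * b)             ≡⟨ cong (λ n → + n +ℤ ℤ.- + (a * b)) (ℕ.*-comm b a) ⟩
  + (a * b) +ℤ ℤ.- + (a * b)             ≡⟨ ℤ.+-inverseʳ (+ (a * b)) ⟩
  + 0                                    ∎
  where open ≡-Reasoning

ShortZeroSumBlock : {I : Set} → (I → ℤ) → ℕ → List I → Set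
ShortZeroSumBlock h B l = ∃[ c ] (c ⊑ l × ∑ℤ h c ≡ + 0 × 1 ≤ length c × length c ≤ B)

signSplit : ∀ {I : Set} (h : I → ℤ) {A} l → All (λ i → ∣ h i ∣ ≤ A × h i ≢ + 0) l →
  ∃[ P ] ∃[ N ] (l ↭ P ++ N × All (λ i → h i ∈1‥ A) P × All (λ i → ℤ.- h i ∈1‥ A) N)
signSplit h l hl =
  let P , N , l↭P++N , 0≤hP , 0≰hN = splitBy (λ i → + 0 ℤ.≤? h i) l
  in P , N , l↭P++N ,
     All.zipWith (λ (hi , 0≤hi) → nonNeg⇒∈1‥ _ hi 0≤hi) (All-⊑ (N , l↭P++N) hl , 0≤hP) ,
     All.zipWith (λ (hi , 0≰hi) → neg⇒-∈1‥ _ hi 0≰hi) (All-⊑ (⊑-complement l↭P++N) hl , 0≰hN)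

ShortZeroSumBlock-⊑ : ∀ {I : Set} {h : I → ℤ} {B m l} → m ⊑ l → ShortZeroSumBlock h B m → ShortZeroSumBlock h B l
ShortZeroSumBlock-⊑ m⊑l (c , c⊑m , zeroSum) = c , ⊑-trans c⊑m m⊑l , zeroSum

balancedBlock : ∀ {I : Set} (h : I → ℤ) {A a b} {P N : List I} → 1 ≤ a → a ≤ A → b ≤ A →
  All (λ i → h i ≡ + a) P → length P ≡ A → All (λ i → ℤ.- h i ≡ + b) N → length N ≡ A →
  ShortZeroSumBlock h (suc (A + A)) (P ++ N)
balancedBlock h {A} {a} {b} {P} {N} 1≤a a≤A b≤A hP |P|≡A hN |N|≡A =
  let c₁ , c₁⊑P , |c₁|≡b = prefix b P (subst (b ≤_) (sym |P|≡A) b≤A)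
      c₂ , c₂⊑N , |c₂|≡a = prefix a N (subst (a ≤_) (sym |N|≡A) a≤A)
      |c|≡b+a = trans (List.length-++ c₁) (cong₂ _+_ |c₁|≡b |c₂|≡a)
  in c₁ ++ c₂ , ⊑-++⁺ c₁⊑P c₂⊑N ,
     ∑ℤ-balanced h c₁ c₂ (All-⊑ c₁⊑P hP) (All-⊑ c₂⊑N hN) |c₁|≡b |c₂|≡a ,
     subst (1 ≤_) (sym |c|≡b+a) (ℕ.≤-trans 1≤a (ℕ.m≤n+m a b)) ,
     subst (_≤ suc (A + A)) (sym |c|≡b+a) (ℕ.m≤n⇒m≤1+n (ℕ.+-mono-≤ b≤A a≤A))

shortZeroSumBlock-nonzero : ∀ {I : Set} (h : I → ℤ) A T l →
  All (λ i → ∣ h i ∣ ≤ A × h i ≢ + 0) l → ∣ ∑ℤ h l ∣ ≤ T → zeroSumThreshold A T < length l →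
  ShortZeroSumBlock h (suc (A + A)) l
shortZeroSumBlock-nonzero h A T l hl ∣∑∣≤T C<|l| =
  let P , N , l↭P++N , hP , hN = signSplit h l hl
      A*A<|P| , A*A<|N| = bothSidesLong h P N hP hN
        (subst (λ z → ∣ z ∣ ≤ T) (∑ℤ.∑-↭ h l↭P++N) ∣∑∣≤T) (subst (_ <_) (↭-length l↭P++N) C<|l|)
      a , 1≤a , a≤A , Pa , Pa⊑P , hPa , |Pa|≡A = pigeonhole h A A P hP A*A<|P|
      b , _   , b≤A , Nb , Nb⊑N , hNb , |Nb|≡A = pigeonhole (ℤ.-_ ∘ h) A A N hN A*A<|N|
  in ShortZeroSumBlock-⊑ (⊑-trans (⊑-++⁺ Pa⊑P Nb⊑N) (↭⇒⊑ l↭P++N))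
       (balancedBlock h 1≤a a≤A b≤A hPa |Pa|≡A hNb |Nb|≡A)

shortZeroSumBlock : ∀ {I : Set} (h : I → ℤ) A T l →
  All (λ i → ∣ h i ∣ ≤ A) l → ∣ ∑ℤ h l ∣ ≤ T → zeroSumThreshold A T < length l →
  ShortZeroSumBlock h (suc (A + A)) l
shortZeroSumBlock h A T l h≤A ∣∑∣≤T C<|l| with splitBy (λ i → h i ℤ.≟ + 0) l
... | i ∷ zs , nz , l↭ , hi≡0 ∷ _ , _ = [ i ] , (zs ++ nz , l↭) , cong (_+ℤ + 0) hi≡0 , s≤s z≤n , s≤s z≤n
... | []     , nz , l↭nz , [] , h≢0 =
  ShortZeroSumBlock-⊑ (↭⇒⊑ l↭nz)
    (shortZeroSumBlock-nonzero h A T nz (All.zip (All-resp-↭ l↭nz h≤A , h≢0))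
      (subst (λ z → ∣ z ∣ ≤ T) (∑ℤ.∑-↭ h l↭nz) ∣∑∣≤T) (subst (_ <_) (↭-length l↭nz) C<|l|))

zeroSumBlocks : ∀ {I : Set} (h : I → ℤ) A T l → All (λ i → ∣ h i ∣ ≤ A) l → ∣ ∑ℤ h l ∣ ≤ T →
  ∃[ bs ] ∃[ R ] (l ↭ concat bs ++ R × All (λ b → ∑ℤ h b ≡ + 0 × length b ≤ suc (A + A)) bs
                  × length R ≤ zeroSumThreshold A T)
zeroSumBlocks {I} h A T l = go (length l) l ℕ.≤-refl
  where
  go : ∀ n l → length l ≤ n → All (λ i → ∣ h i ∣ ≤ A) l → ∣ ∑ℤ h l ∣ ≤ T →
    ∃[ bs ] ∃[ R ] (l ↭ concat bs ++ R × All (λ b → ∑ℤ h b ≡ + 0 × length b ≤ suc (A + A)) bs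
                    × length R ≤ zeroSumThreshold A T)
  go n l |l|≤n h≤A ∣∑∣≤T with length l ℕ.≤? zeroSumThreshold A T
  go n       l |l|≤n h≤A ∣∑∣≤T | yes |l|≤C = [] , l , ↭-refl , [] , |l|≤C
  go zero    l |l|≤0 h≤A ∣∑∣≤T | no |l|≰C  = ⊥-elim (|l|≰C (ℕ.≤-trans |l|≤0 z≤n))
  go (suc n) l |l|≤n h≤A ∣∑∣≤T | no |l|≰C  =
    let c , (r , l↭c++r) , ∑c≡0 , 1≤|c| , |c|≤ = shortZeroSumBlock h A T l h≤A ∣∑∣≤T (ℕ.≰⇒> |l|≰C)
        |r|≤n = ℕ.≤-pred (ℕ.≤-trans (ℕ.+-monoˡ-≤ (length r) 1≤|c|)
                  (subst (_≤ suc n) (length-⊑ (r , l↭c++r)) |l|≤n))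
        bs , R , r↭ , blocks , |R|≤C = go n r |r|≤n (All-⊑ (⊑-complement l↭c++r) h≤A)
          (subst (λ z → ∣ z ∣ ≤ T) (∑ℤ.∑-↭-zeroSum h c r l↭c++r ∑c≡0) ∣∑∣≤T)
    in c ∷ bs , R ,
       ↭-trans l↭c++r (↭-trans (++⁺ˡ c r↭) (↭-reflexive (sym (List.++-assoc c (concat bs) R)))) ,
       (∑c≡0 , |c|≤) ∷ blocks , |R|≤C

-- Induction on the dimension

concat-↭ : ∀ {I : Set} {bs cs : List (List I)} → bs ↭ cs → concat bs ↭ concat cs
concat-↭ = ↭ₛ.foldr-commMonoid ↭-setoid ++-isCommutativeMonoid ∘ ↭⇒↭ₛ′ ↭-isEquivalence

length-concat≤ : ∀ {I : Set} {B} (bs : List (List I)) → All (λ b → length b ≤ B) bs →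
  length (concat bs) ≤ length bs * B
length-concat≤ []       []               = z≤n
length-concat≤ (b ∷ bs) (|b|≤B ∷ |bs|≤B) =
  subst (_≤ _) (sym (List.length-++ b)) (ℕ.+-mono-≤ |b|≤B (length-concat≤ bs |bs|≤B))

↭-concat-split : ∀ {I : Set} {l R : List I} {bs} Z W → l ↭ concat bs ++ R → bs ↭ Z ++ W →
  l ↭ concat Z ++ concat W ++ R
↭-concat-split {l = l} {R} {bs} Z W l↭ bs↭ = begin
  l                            ↭⟨ l↭ ⟩
  concat bs ++ R               ↭⟨ ++⁺ʳ R (concat-↭ bs↭) ⟩
  concat (Z ++ W) ++ R         ≡⟨ cong (_++ R) (List.concat-++ Z W) ⟨
  (concat Z ++ concat W) ++ R  ≡⟨ List.++-assoc (concat Z) (concat W) R ⟩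
  concat Z ++ concat W ++ R    ∎
  where open PermutationReasoning

module _ {d : ℕ} {I : Set} (g : I → Point d) where

  InBox-blockSums : ∀ {A B} bs → All (λ b → length b ≤ B) bs → All (InBox A ∘ g) (concat bs) →
    All (λ b → InBox (B * A) (∑ᵥ g b)) bs
  InBox-blockSums {A} bs |bs|≤B g∈A = All.zipWith
    (λ (|b|≤B , gb∈A) → InBox-mono (ℕ.*-monoˡ-≤ A |b|≤B) (InBox-∑ g gb∈A))
    (|bs|≤B , All.concat⁻ g∈A)

  ∑ᵥ-blockSums : ∀ {l} bs R → l ↭ concat bs ++ R → ∑ᵥ (∑ᵥ g) bs ≡ ∑ᵥ g l -ᵥ ∑ᵥ g R
  ∑ᵥ-blockSums {l} bs R l↭ = begin
    ∑ᵥ (∑ᵥ g) bs                                   ≡⟨ ∑ᵥ.∑-concat g bs ⟩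
    ∑ᵥ g (concat bs)                               ≡⟨ ℤᵈ.//-rightDividesʳ (∑ᵥ g R) _ ⟨
    (∑ᵥ g (concat bs) +ᵥ ∑ᵥ g R) -ᵥ ∑ᵥ g R          ≡⟨ cong (_-ᵥ ∑ᵥ g R) (∑ᵥ.∑-++ g (concat bs) R) ⟨
    ∑ᵥ g (concat bs ++ R) -ᵥ ∑ᵥ g R                 ≡⟨ cong (_-ᵥ ∑ᵥ g R) (∑ᵥ.∑-↭ g l↭) ⟨
    ∑ᵥ g l -ᵥ ∑ᵥ g R                                ∎
    where open ≡-Reasoning

  InBox-∑blockSums : ∀ {A T C l} bs R → l ↭ concat bs ++ R → InBox T (∑ᵥ g l) →
    All (InBox A ∘ g) R → length R ≤ C → InBox (T + C * A) (∑ᵥ (∑ᵥ g) bs)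
  InBox-∑blockSums {A} bs R l↭ ∑l∈T R∈A |R|≤C =
    subst (InBox _) (sym (∑ᵥ-blockSums bs R l↭))
      (InBox-+ ∑l∈T (InBox-neg (InBox-mono (ℕ.*-monoˡ-≤ A |R|≤C) (InBox-∑ g R∈A))))

∑ᵥ-concat-zero : ∀ {d} {I : Set} (f : I → Point (suc d)) Z →
  All (λ b → ∑ℤ (head ∘ f) b ≡ + 0) Z → ∑ᵥ (∑ᵥ (tail ∘ f)) Z ≡ 0ᵥ → ∑ᵥ f (concat Z) ≡ 0ᵥ
∑ᵥ-concat-zero f Z ∑h≡0 ∑∑g≡0 = trans (∑ᵥ-∷ f (concat Z)) (cong₂ _∷_
  (trans (sym (∑ℤ.∑-concat (head ∘ f) Z)) (∑ℤ.∑-ε (∑ℤ (head ∘ f)) ∑h≡0))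
  (trans (sym (∑ᵥ.∑-concat (tail ∘ f) Z)) ∑∑g≡0))

-- The blocks of the first coordinate have at most 2A + 1 items, so their remaining coordinates
-- sum to vectors in the box of radius (2A + 1)A; their total is ∑ l minus the leftover R, in the
-- box of radius T + C·A with C = zeroSumThreshold A T.
remainderBound : ℕ → ℕ → ℕ → ℕ
remainderBound zero    A T = 0
remainderBound (suc d) A T =
  remainderBound d (suc (A + A) * A) (T + zeroSumThreshold A T * A) * suc (A + A) + zeroSumThreshold A T

zeroSumSplit : ∀ d A T {I : Set} (f : I → Point d) l → All (InBox A ∘ f) l → InBox T (∑ᵥ f l) →
  ∃[ l₀ ] ∃[ r ] (l ↭ l₀ ++ r × ∑ᵥ f l₀ ≡ 0ᵥ × length r ≤ remainderBound d A T)
zeroSumSplit zero    A T f l _ _ = l , [] , ↭-reflexive (sym (List.++-identityʳ l)) , ∑ᵥ-dim0 , z≤n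
  where
  ∑ᵥ-dim0 : ∑ᵥ f l ≡ []
  ∑ᵥ-dim0 with ∑ᵥ f l
  ... | [] = refl
zeroSumSplit (suc d) A T f l f∈A ∑∈T =
  let h = head ∘ f
      g = tail ∘ f
      B = suc (A + A)
      C = zeroSumThreshold A T
      ∑h≤T , ∑g∈T = Vec.uncons (subst (InBox T) (∑ᵥ-∷ f l) ∑∈T)
      bs , R , l↭ , blocks , |R|≤C = zeroSumBlocks h A T l (All.map InBox-head f∈A) ∑h≤T
      g∈A = All-resp-↭ l↭ (All.map InBox-tail f∈A)
      Z , W , bs↭ , ∑Z≡0 , |W|≤ = zeroSumSplit d (B * A) (T + C * A) (∑ᵥ g) bs
        (InBox-blockSums g bs (All.map proj₂ blocks) (All.++⁻ˡ (concat bs) g∈A))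
        (InBox-∑blockSums g bs R l↭ ∑g∈T (All.++⁻ʳ (concat bs) g∈A) |R|≤C)
      |concatW|≤ = ℕ.≤-trans (length-concat≤ W (All.map proj₂ (All-⊑ (⊑-complement {b = Z} bs↭) blocks)))
                             (ℕ.*-monoˡ-≤ B |W|≤)
  in concat Z , concat W ++ R ,
     ↭-concat-split Z W l↭ bs↭ ,
     ∑ᵥ-concat-zero f Z (All.map proj₁ (All-⊑ (W , bs↭) blocks)) ∑Z≡0 ,
     subst (_≤ _) (sym (List.length-++ (concat W))) (ℕ.+-mono-≤ |concatW|≤ |R|≤C)

-- Signed generators

module _ {d : ℕ} (X : Point d → Set) where

  SignedGenerator : Set
  SignedGenerator = Σ (Point d) X ⊎ Σ (Point d) X

  value : SignedGenerator → Point d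
  value (inj₁ (v , _)) = v
  value (inj₂ (v , _)) = -ᵥ v

  ∑ᵥ-value-swap : ∀ l → ∑ᵥ value (map swap l) ≡ -ᵥ ∑ᵥ value l
  ∑ᵥ-value-swap []      = sym ℤᵈ.ε⁻¹≈ε
  ∑ᵥ-value-swap (t ∷ l) =
    trans (cong₂ _+ᵥ_ (value-swap t) (∑ᵥ-value-swap l)) (ℤᵈ.⁻¹-∙-comm (value t) (∑ᵥ value l))
    where
    value-swap : ∀ t → value (swap t) ≡ -ᵥ value t
    value-swap (inj₁ _)       = refl
    value-swap (inj₂ (v , _)) = sym (ℤᵈ.⁻¹-involutive v)

  InLattice⇒signedSum : ∀ {x} → InLattice X x → ∃[ l ] ∑ᵥ value l ≡ x
  InLattice⇒signedSum (gen {v} v∈X) = [ inj₁ (v , v∈X) ] , ℤᵈ.identityʳ v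
  InLattice⇒signedSum zero          = [] , refl
  InLattice⇒signedSum (add x∈L y∈L) with InLattice⇒signedSum x∈L | InLattice⇒signedSum y∈L
  ... | l₁ , refl | l₂ , refl = l₁ ++ l₂ , ∑ᵥ.∑-++ value l₁ l₂
  InLattice⇒signedSum (neg x∈L) with InLattice⇒signedSum x∈L
  ... | l , refl = map swap l , ∑ᵥ-value-swap l

  signedSum⇒difference : ∀ l → ∃[ S₁ ] ∃[ S₂ ] (All X S₁ × All X S₂ × length S₁ + length S₂ ≡ length l
                                                × (sumᵥ S₁ -ᵥ sumᵥ S₂) ≡ ∑ᵥ value l)
  signedSum⇒difference [] = [] , [] , [] , [] , refl , ℤᵈ.inverseʳ 0ᵥ
  signedSum⇒difference (inj₁ (v , v∈X) ∷ l) with signedSum⇒difference l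
  ... | S₁ , S₂ , X₁ , X₂ , |S| , S₁-S₂≡ =
    v ∷ S₁ , S₂ , v∈X ∷ X₁ , X₂ , cong suc |S| ,
    trans (ℤᵈ.assoc v (sumᵥ S₁) (-ᵥ sumᵥ S₂)) (cong (v +ᵥ_) S₁-S₂≡)
  signedSum⇒difference (inj₂ (v , v∈X) ∷ l) with signedSum⇒difference l
  ... | S₁ , S₂ , X₁ , X₂ , |S| , S₁-S₂≡ =
    S₁ , v ∷ S₂ , X₁ , v∈X ∷ X₂ , trans (ℕ.+-suc (length S₁) (length S₂)) (cong suc |S|) , (begin
      sumᵥ S₁ +ᵥ (-ᵥ (v +ᵥ sumᵥ S₂))            ≡⟨ cong (sumᵥ S₁ +ᵥ_) (ℤᵈ.⁻¹-∙-comm v (sumᵥ S₂)) ⟨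
      sumᵥ S₁ +ᵥ ((-ᵥ v) +ᵥ (-ᵥ sumᵥ S₂))       ≡⟨ ℤᵈ.x∙yz≈y∙xz (sumᵥ S₁) (-ᵥ v) (-ᵥ sumᵥ S₂) ⟩
      (-ᵥ v) +ᵥ (sumᵥ S₁ -ᵥ sumᵥ S₂)            ≡⟨ cong ((-ᵥ v) +ᵥ_) S₁-S₂≡ ⟩
      (-ᵥ v) +ᵥ ∑ᵥ value l                      ∎)
    where open ≡-Reasoning

  InBox-value : ∀ r → (∀ {v} → X v → InBall r v) → ∀ t → InBox r (value t)
  InBox-value r X⊆B (inj₁ (v , v∈X)) = InBall⇒InBox r (X⊆B v∈X)
  InBox-value r X⊆B (inj₂ (v , v∈X)) = InBox-neg (InBall⇒InBox r (X⊆B v∈X))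

proposition4p7 : (k d : ℕ) → 1 ≤ k → 1 ≤ d →
    ∃[ s₀ ] ((s : ℕ) → s₀ ≤ s →
      (X : Point d → Set) → (∀ {v} → X v → InBall (2 * k) v) →
      (x : Point d) → InLattice X x → InBall (2 * k) x →
      ∃[ S₁ ] ∃[ S₂ ] (All X S₁ × All X S₂ × length S₁ ≤ s × length S₂ ≤ s
        × (sumᵥ S₁ -ᵥ sumᵥ S₂) ≡ x))
proposition4p7 k d _ _ = remainderBound d (2 * k) (2 * k) , λ s s₀≤s X X⊆B x x∈L x∈B →
  let l , ∑l≡x = InLattice⇒signedSum X x∈L
      l₀ , r , l↭l₀++r , ∑l₀≡0 , |r|≤s₀ = zeroSumSplit d (2 * k) (2 * k) (value X) l
        (All.tabulate λ {t} _ → InBox-value X (2 * k) X⊆B t)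
        (subst (InBox (2 * k)) (sym ∑l≡x) (InBall⇒InBox (2 * k) x∈B))
      S₁ , S₂ , X₁ , X₂ , |S₁|+|S₂|≡|r| , S₁-S₂≡ = signedSum⇒difference X r
      |S₁|+|S₂|≤s = ℕ.≤-trans (ℕ.≤-reflexive |S₁|+|S₂|≡|r|) (ℕ.≤-trans |r|≤s₀ s₀≤s)
  in S₁ , S₂ , X₁ , X₂ ,
     ℕ.≤-trans (ℕ.m≤m+n (length S₁) (length S₂)) |S₁|+|S₂|≤s ,
     ℕ.≤-trans (ℕ.m≤n+m (length S₂) (length S₁)) |S₁|+|S₂|≤s ,
     trans S₁-S₂≡ (trans (sym (∑ᵥ.∑-↭-zeroSum (value X) l₀ r l↭l₀++r ∑l₀≡0)) ∑l≡x)
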